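{- There is a polynomial $\mathbf{ResSV}$ proof of $(\Box,1)$ from $\mathit{PHP}$: for every $m\ge1$ there is a proof $\mathit{PHP}_m\vdash_{\mathbf{ResSV}}\{(\Box,1)\}$ whose length is bounded by a polynomial in $m$.
   Context: A literal is a Boolean variable $x$ or its negation $\overline x$; a clause is a disjunction of literals ($\Box$ is the empty clause). Weights are elements of $\mathbb{R}_{>0}\cup\{\infty\}$ with $\infty+w=\infty-w=\infty$; during $\mathbf{ResSV}$ proofs clauses may also carry finite negative weights. A MaxSAT formula is a finite collection of weighted clauses $(C,w)$, where $(C,u),(C,v)$ may be merged into $(C,u+v)$ and conversely, and clauses of weight $0$ disappear. $\mathcal G\subseteq\mathcal F$ means every $(C,w)\in\mathcal G$ has some $(C,w')\in\mathcal F$ with $w\le w'$. A MaxSAT inference rule replaces its antecedents in the current formula by its consequents. A proof is a sequence $\mathcal F_0;\dots;\mathcal F_e$ (length $e$), each obtained from the previous by one rule application; $\mathcal F\vdash_{\mathbf{ResSV}}\mathcal G$ means there is such a proof with $\mathcal F_0=\mathcal F$, $\mathcal G\subseteq\mathcal F_e$ and all clauses of $\mathcal F_e$ having positive weight. $\mathbf{ResSV}$ rules: Resolution: from $(x\lor A,v),(\overline x\lor B,w)$ with $v,w$ positive ($A,B$ possibly empty), with $m=\min\{v,w\}$, derive $(A\lor B,m),(x\lor A,v-m),(\overline x\lor B,w-m),(x\lor A\lor\overline B,m),(\overline x\lor B\lor\overline A,m)$, where for $D=l_1\lor\dots\lor l_p$ the expression $(E\lor\overline D,u)$ stands for $(E\lor\overline{l_1},u),(E\lor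 l_1\lor\overline{l_2},u),\dots,(E\lor l_1\lor\dots\lor l_{p-1}\lor\overline{l_p},u)$ (nothing if $D$ is empty), and tautologies are discarded. Split: from $(A,w)$ with $w$ positive derive $(A\lor x,w),(A\lor\overline x,w)$. Virtual: with no antecedents, introduce $(A,w),(A,-w)$ for any clause $A$ and finite $w$. Pigeon hole problem: for $m\ge1$ take variables $x_{ij}$, $1\le i\le m+1$, $1\le j\le m$; let $\mathcal K_m$ consist of the clauses $x_{i1}\lor\dots\lor x_{im}$ for each $i$ and $\overline x_{ij}\lor\overline x_{i'j}$ for each $j$ and $1\le i<i'\le m+1$. $\mathit{PHP}_m=\{(C,\infty)\mid C\in\mathcal K_m\}$. -}

module Defs where

open import Data.Nat as ℕ using (ℕ; zero; suc; _∸_)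
open import Data.Nat.Properties as ℕP using ()
open import Data.Product using (Σ; ∃; ∃-syntax; _×_; _,_; proj₁; proj₂)
open import Data.Product.Properties using (≡-dec)
open import Data.List using (List; []; _∷_; _++_; [_]; map; concatMap; upTo; filter)
open import Data.List.Membership.Propositional using (_∈_)
open import Data.List.Relation.Unary.All using (All)
open import Data.List.Relation.Unary.Any using (Any)
open import Data.List.Relation.Unary.Any as Any using (any?)
open import Data.List.Relation.Binary.Permutation.Propositional using (_↭_)
open import Data.Rational using (ℚ; 0ℚ; 1ℚ; -_) renaming (_+_ to _+ℚ_; _-_ to _-ℚ_; _⊓_ to _⊓ℚ_; _<_ to _<ℚ_; _≤_ to _≤ℚ_)
open import Relation.Nullary using (Dec; yes; no; ¬_; ¬?)
open import Relation.Binary.Definitions using (DecidableEquality)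
open import Relation.Binary.PropositionalEquality using (_≡_; refl; cong)
import Data.List.Membership.DecPropositional as DecMem

Var : Set
Var = ℕ × ℕ

data Lit : Set where
  pos : Var → Lit
  neg : Var → Lit

_≟L_ : DecidableEquality Lit
pos x ≟L pos y with ≡-dec ℕP._≟_ ℕP._≟_ x y
... | yes refl = yes refl
... | no ne = no λ { refl → ne refl }
pos x ≟L neg y = no λ ()
neg x ≟L pos y = no λ ()
neg x ≟L neg y with ≡-dec ℕP._≟_ ℕP._≟_ x y
... | yes refl = yes refl
... | no ne = no λ { refl → ne refl }

comp : Lit → Lit
comp (pos x) = neg x
comp (neg x) = pos x

-- Clauses are identified up to having the same
-- set of literals (see _~_ and the rename move of reshaping below).
Clause : Set
Clause = List Lit

□ : Clause
□ = []

_~_ : Clause → Clause → Set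
C ~ D = (∀ l → l ∈ C → l ∈ D) × (∀ l → l ∈ D → l ∈ C)

Taut : Clause → Set
Taut C = Any (λ l → comp l ∈ C) C

taut? : (C : Clause) → Dec (Taut C)
taut? C = any? (λ l → DecMem._∈?_ _≟L_ (comp l) C) C

-- Weights: finite (rational, possibly negative during proofs) or ∞

data W : Set where
  fin : ℚ → W
  ∞   : W

_⊕_ : W → W → W
fin a ⊕ fin b = fin (a +ℚ b)
fin a ⊕ ∞     = ∞
∞     ⊕ _     = ∞

-- v ⊖ m with the convention ∞ - w = ∞.  (The case fin ⊖ ∞ never arises
-- below, since it is only used with m = min of weights and m ≤ v.)
_⊖_ : W → W → W
fin a ⊖ fin b = fin (a -ℚ b)
fin a ⊖ ∞     = fin 0ℚ
∞     ⊖ _     = ∞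

minW : W → W → W
minW (fin a) (fin b) = fin (a ⊓ℚ b)
minW (fin a) ∞       = fin a
minW ∞       w       = w

data Pos : W → Set where
  pos-fin : ∀ {q} → 0ℚ <ℚ q → Pos (fin q)
  pos-∞   : Pos ∞

data _≤W_ : W → W → Set where
  fin≤fin : ∀ {a b} → a ≤ℚ b → fin a ≤W fin b
  w≤∞     : ∀ {w} → w ≤W ∞

WClause : Set
WClause = Clause × W

Formula : Set
Formula = List WClause

-- One reshaping move: the same collection of weighted clauses, presented
-- differently (reordering, merging (C,u),(C,v) into (C,u+v), conversely
-- splitting a weight into two positive weights, dropping weight-0 clauses,
-- identifying clauses with the same literal set).
data Reshape₁ : Formula → Formula → Set where
  perm    : ∀ {F G} → F ↭ G → Reshape₁ F G
  merge   : ∀ {C u v F} → Reshape₁ ((C , u) ∷ (C , v) ∷ F) ((C , u ⊕ v) ∷ F)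
  unmerge : ∀ {C u v F} → Pos u → Pos v →
            Reshape₁ ((C , u ⊕ v) ∷ F) ((C , u) ∷ (C , v) ∷ F)
  drop0   : ∀ {C F} → Reshape₁ ((C , fin 0ℚ) ∷ F) F
  rename  : ∀ {C D w F} → C ~ D → Reshape₁ ((C , w) ∷ F) ((D , w) ∷ F)

data Reshape : Formula → Formula → Set where
  done : ∀ {F} → Reshape F F
  more : ∀ {F G H} → Reshape₁ F G → Reshape G H → Reshape F H

-- (E ∨ ¬D , u) for D = l₁ ∨ … ∨ lₚ:
--   (E ∨ l̄₁ , u), (E ∨ l₁ ∨ l̄₂ , u), …, (E ∨ l₁ ∨ … ∨ lₚ₋₁ ∨ l̄ₚ , u)
negExp : Clause → Clause → W → Formula
negExp E []      u = []
negExp E (l ∷ D) u = (comp l ∷ E , u) ∷ negExp (l ∷ E) D u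

noTaut : Formula → Formula
noTaut = filter (λ Cw → ¬? (taut? (proj₁ Cw)))

data Rule : Formula → Formula → Set where
  resolution : ∀ (x : Var) (A B : Clause) (v w : W) → Pos v → Pos w →
    Rule ((pos x ∷ A , v) ∷ (neg x ∷ B , w) ∷ [])
         (noTaut (let m = minW v w in
             (A ++ B , m) ∷ (pos x ∷ A , v ⊖ m) ∷ (neg x ∷ B , w ⊖ m) ∷
             (negExp (pos x ∷ A) B m ++ negExp (neg x ∷ B) A m)))
  split : ∀ (A : Clause) (x : Var) (w : W) → Pos w →
    Rule ((A , w) ∷ []) ((pos x ∷ A , w) ∷ (neg x ∷ A , w) ∷ [])
  virtual : ∀ (A : Clause) (w : ℚ) →
    Rule [] ((A , fin w) ∷ (A , fin (- w)) ∷ [])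

Step : Formula → Formula → Set
Step F G = ∃[ Ant ] ∃[ Cons ] ∃[ R ]
  (Rule Ant Cons × Reshape F (Ant ++ R) × G ≡ Cons ++ R)

data Steps : Formula → ℕ → Formula → Set where
  [] : ∀ {F} → Steps F 0 F
  _∷_ : ∀ {F G H e} → Step F G → Steps G e H → Steps F (suc e) H

_⊑_ : Formula → Formula → Set
G ⊑ F = All (λ Cw → ∃[ w' ] ((proj₁ Cw , w') ∈ F
                              × proj₂ Cw ≤W w')) G

ProvesIn : Formula → Formula → ℕ → Set
ProvesIn F G e = ∃[ Fe ] (Steps F e Fe ×
  ∃[ F' ] (Reshape Fe F' × All (λ Cw → Pos (proj₂ Cw)) F' × G ⊑ F'))

range1 : ℕ → List ℕ
range1 n = map suc (upTo n)

x : ℕ → ℕ → Var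
x i j = (i , j)

K : ℕ → List Clause
K m = map (λ i → map (λ j → pos (x i j)) (range1 m)) (range1 (suc m))
   ++ concatMap (λ j → concatMap (λ i →
        map (λ d → neg (x i j) ∷ neg (x (i ℕ.+ suc d) j) ∷ [])
            (upTo (suc m ∸ i)))
        (range1 (suc m))) (range1 m)

PHP : ℕ → Formula
PHP m = map (λ C → (C , ∞)) (K m)

module Submission where

-- For every hole j, the virtual rule introduces (□,1) together with (□,−1).  Splitting
-- (□,1) successively on x₁ⱼ, …, x₍ₘ₊₁₎ⱼ and resolving each new branch x̄ₖⱼ ∨ x₁ⱼ ∨ … ∨ x₍ₖ₋₁₎ⱼ
-- against the hard clauses x̄ᵢⱼ ∨ x̄ₖⱼ turns (□,1) into the m+1 units (x̄ᵢⱼ,1) in O(m²) steps.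
-- Each pigeon i then resolves a weight-1 copy of its hard clause xᵢ₁ ∨ … ∨ xᵢₘ against its
-- m units (x̄ᵢⱼ,1), one per hole, to obtain (□,1).  The m+1 copies of (□,1) absorb the m
-- copies of (□,−1), and (□,1) remains after O(m³) steps.

open import Defs
open import Data.Nat using (ℕ; zero; suc; _≤_; _<_; _+_; _*_; _^_; _∸_; z≤n; s≤s)
open import Data.Nat.Properties
open import Data.Nat.Solver using (module +-*-Solver)
open import Data.Product using (∃-syntax; _×_; _,_; proj₁; proj₂)
open import Data.Sum using (_⊎_; inj₁; inj₂)
open import Data.List using (List; []; _∷_; _++_; [_]; map; replicate; concatMap; length; upTo; downFrom)
open import Data.List.Properties using (++-assoc; ++-identityʳ; filter-accept; length-map; length-upTo; length-downFrom)
open import Data.List.Relation.Unary.All as All using (All; []; _∷_)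
open import Data.List.Relation.Unary.All.Properties using (++⁺; filter⁺; map⁺)
open import Data.List.Relation.Unary.Any using (here; there)
open import Data.List.Membership.Propositional using (_∈_; find)
open import Data.List.Membership.Propositional.Properties
  using (∈-∃++; ∈-++⁻; ∈-++⁺ˡ; ∈-++⁺ʳ; ∈-map⁺; ∈-map⁻; ∈-upTo⁺; ∈-downFrom⁻; ∈-concat⁺′)
open import Data.List.Relation.Binary.Permutation.Propositional
  using (_↭_; ↭-refl; ↭-sym; ↭-trans; ↭-reflexive; prep)
import Data.List.Relation.Binary.Permutation.Propositional.Properties as ↭
open import Data.Rational using (0ℚ; 1ℚ; -_)
import Data.Rational.Properties as ℚ
open import Relation.Binary.PropositionalEquality using (_≡_; refl; sym; trans; cong; subst)
open import Relation.Nullary using (¬_; ¬?)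

Pos₀ : W → Set
Pos₀ w = Pos w ⊎ w ≡ fin 0ℚ

Pos₀ᶠ : Formula → Set
Pos₀ᶠ = All (λ c → Pos₀ (proj₂ c))

Posᶠ : Formula → Set
Posᶠ = All (λ c → Pos (proj₂ c))

Pos-1 : Pos (fin 1ℚ)
Pos-1 = pos-fin (ℚ.positive⁻¹ 1ℚ)

≤W-refl : ∀ w → w ≤W w
≤W-refl (fin q) = fin≤fin ℚ.≤-refl
≤W-refl ∞       = w≤∞

⊆⇒⊑ : ∀ {G F} → (∀ {c} → c ∈ G → c ∈ F) → G ⊑ F
⊆⇒⊑ G⊆F = All.tabulate λ {c} c∈G → proj₂ c , G⊆F c∈G , ≤W-refl (proj₂ c)

Posᶠ-hard : ∀ Cs → Posᶠ (map (λ C → (C , ∞)) Cs)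
Posᶠ-hard Cs = map⁺ (All.universal (λ _ → pos-∞) Cs)

Reshape-trans : ∀ {F G H} → Reshape F G → Reshape G H → Reshape F H
Reshape-trans done        q = q
Reshape-trans (more r p) q = more r (Reshape-trans p q)

↭⇒Reshape : ∀ {F G} → F ↭ G → Reshape F G
↭⇒Reshape p = more (perm p) done

Reshape₁-++ʳ : ∀ {F G} R → Reshape₁ F G → Reshape₁ (F ++ R) (G ++ R)
Reshape₁-++ʳ R (perm p)        = perm (↭.++⁺ʳ R p)
Reshape₁-++ʳ R merge           = merge
Reshape₁-++ʳ R (unmerge pu pv) = unmerge pu pv
Reshape₁-++ʳ R drop0           = drop0
Reshape₁-++ʳ R (rename C~D)    = rename C~D

Reshape-++ʳ : ∀ {F G} R → Reshape F G → Reshape (F ++ R) (G ++ R)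
Reshape-++ʳ R done       = done
Reshape-++ʳ R (more r p) = more (Reshape₁-++ʳ R r) (Reshape-++ʳ R p)

dropZeros : ∀ P J → Pos₀ᶠ J → ∃[ J' ] (Reshape (P ++ J) (P ++ J') × Posᶠ J')
dropZeros P []      []                    = [] , done , []
dropZeros P (c ∷ J) (inj₁ pos-c ∷ J≥0) with dropZeros (P ++ [ c ]) J J≥0
... | J' , r , posJ' =
  c ∷ J' ,
  Reshape-trans (↭⇒Reshape (↭-reflexive (sym (++-assoc P [ c ] J))))
    (Reshape-trans r (↭⇒Reshape (↭-reflexive (++-assoc P [ c ] J')))) ,
  pos-c ∷ posJ'
dropZeros P ((C , _) ∷ J) (inj₂ refl ∷ J≥0) with dropZeros P J J≥0
... | J' , r , posJ' = J' , more (perm (↭.shift (C , fin 0ℚ) P J)) (more drop0 r) , posJ'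

Step-reshapeˡ : ∀ {F F' G} → Reshape F F' → Step F' G → Step F G
Step-reshapeˡ r (Ant , Cons , R , rule , r' , eq) = Ant , Cons , R , rule , Reshape-trans r r' , eq

Step-++ʳ : ∀ {F G} R' → Step F G → Step (F ++ R') (G ++ R')
Step-++ʳ R' (Ant , Cons , R , rule , r , refl) =
  Ant , Cons , R ++ R' , rule ,
  Reshape-trans (Reshape-++ʳ R' r) (↭⇒Reshape (↭-reflexive (++-assoc Ant R R'))) ,
  ++-assoc Cons R R'

Steps-++ʳ : ∀ {F G k} R → Steps F k G → Steps (F ++ R) k (G ++ R)
Steps-++ʳ R []       = []
Steps-++ʳ R (s ∷ ss) = Step-++ʳ R s ∷ Steps-++ʳ R ss

Steps-trans : ∀ {F G H a b} → Steps F a G → Steps G b H → Steps F (a + b) H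
Steps-trans []       q = q
Steps-trans (s ∷ p) q = s ∷ Steps-trans p q

Steps-reshapeˡ : ∀ {F F' G k} → Reshape F F' → Steps F' k G → ∃[ G' ] (Steps F k G' × Reshape G' G)
Steps-reshapeˡ r []       = _ , [] , r
Steps-reshapeˡ r (s ∷ ss) = _ , Step-reshapeˡ r s ∷ ss , done

-- Consequents that are no longer needed go to the residue: its zero-weight clauses are
-- dropped at the end of the proof, the positive ones are simply kept.
record _⇒⟨_⟩_ (F : Formula) (n : ℕ) (G : Formula) : Set where
  constructor derivation
  field
    size : ℕ
    size≤n : size ≤ n
    end : Formula
    steps : Steps F size end
    residue : Formula
    end↝ : Reshape end (G ++ residue)
    residue≥0 : Pos₀ᶠ residue

infixr 4 _⨾_
_⨾_ : ∀ {F G H a b} → F ⇒⟨ a ⟩ G → G ⇒⟨ b ⟩ H → F ⇒⟨ a + b ⟩ H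
derivation k₁ k₁≤ _ π₁ J₁ r₁ z₁ ⨾ derivation k₂ k₂≤ _ π₂ J₂ r₂ z₂
  with Steps-reshapeˡ r₁ (Steps-++ʳ J₁ π₂)
... | E , π , r =
  derivation (k₁ + k₂) (+-mono-≤ k₁≤ k₂≤) E (Steps-trans π₁ π) (J₂ ++ J₁)
    (Reshape-trans r (Reshape-trans (Reshape-++ʳ J₁ r₂) (↭⇒Reshape (↭-reflexive (++-assoc _ J₂ J₁)))))
    (++⁺ z₂ z₁)

weaken : ∀ {F G a b} → a ≤ b → F ⇒⟨ a ⟩ G → F ⇒⟨ b ⟩ G
weaken a≤b (derivation k k≤a E π J r z) = derivation k (≤-trans k≤a a≤b) E π J r z

⇒-refl : ∀ {F} → F ⇒⟨ 0 ⟩ F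
⇒-refl {F} = derivation 0 z≤n F [] [] (↭⇒Reshape (↭-reflexive (sym (++-identityʳ F)))) []

reshape-pre : ∀ {F F' G n} → Reshape F F' → F' ⇒⟨ n ⟩ G → F ⇒⟨ n ⟩ G
reshape-pre r (derivation k k≤n E π J r' z) with Steps-reshapeˡ r π
... | E' , π' , r'' = derivation k k≤n E' π' J (Reshape-trans r'' r') z

reshape-post : ∀ {F G G' n} → F ⇒⟨ n ⟩ G → Reshape G G' → F ⇒⟨ n ⟩ G'
reshape-post (derivation k k≤n E π J r z) r' = derivation k k≤n E π J (Reshape-trans r (Reshape-++ʳ J r')) z

forgetʳ : ∀ {F G J n} → Pos₀ᶠ J → F ⇒⟨ n ⟩ (G ++ J) → F ⇒⟨ n ⟩ G
forgetʳ {G = G} {J} J≥0 (derivation k k≤n E π J' r z) =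
  derivation k k≤n E π (J ++ J') (Reshape-trans r (↭⇒Reshape (↭-reflexive (++-assoc G J J')))) (++⁺ J≥0 z)

rule⇒ : ∀ {Ant Cons} → Rule Ant Cons → Ant ⇒⟨ 1 ⟩ Cons
rule⇒ {Ant} {Cons} rule =
  derivation 1 ≤-refl (Cons ++ [])
    ((Ant , Cons , [] , rule , ↭⇒Reshape (↭-reflexive (sym (++-identityʳ Ant))) , refl) ∷ [])
    [] done []

++-swapʳ : ∀ (X Y Z : Formula) → (X ++ Y) ++ Z ↭ (X ++ Z) ++ Y
++-swapʳ X Y Z = ↭-trans (↭-reflexive (++-assoc X Y Z))
                   (↭-trans (↭.++⁺ˡ X (↭.++-comm Y Z)) (↭-reflexive (sym (++-assoc X Z Y))))

⇒-++ʳ : ∀ {F G n} R → F ⇒⟨ n ⟩ G → (F ++ R) ⇒⟨ n ⟩ (G ++ R)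
⇒-++ʳ {G = G} R (derivation k k≤n E π J r z) =
  derivation k k≤n (E ++ R) (Steps-++ʳ R π) J (Reshape-trans (Reshape-++ʳ R r) (↭⇒Reshape (++-swapʳ G J R))) z

record _⊢_⇒⟨_⟩_ (H F : Formula) (n : ℕ) (G : Formula) : Set where
  constructor inContext
  field plain : (F ++ H) ⇒⟨ n ⟩ (G ++ H)

infixr 4 _⨾ₕ_ _↝⨾_
infixl 3 _⨾↝_

_⨾ₕ_ : ∀ {H F G K a b} → H ⊢ F ⇒⟨ a ⟩ G → H ⊢ G ⇒⟨ b ⟩ K → H ⊢ F ⇒⟨ a + b ⟩ K
inContext d ⨾ₕ inContext e = inContext (d ⨾ e)

_↝⨾_ : ∀ {H F F' G n} → Reshape F F' → H ⊢ F' ⇒⟨ n ⟩ G → H ⊢ F ⇒⟨ n ⟩ G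
_↝⨾_ {H} r (inContext d) = inContext (reshape-pre (Reshape-++ʳ H r) d)

_⨾↝_ : ∀ {H F G G' n} → H ⊢ F ⇒⟨ n ⟩ G → Reshape G G' → H ⊢ F ⇒⟨ n ⟩ G'
_⨾↝_ {H} (inContext d) r = inContext (reshape-post d (Reshape-++ʳ H r))

hweaken : ∀ {H F G a b} → a ≤ b → H ⊢ F ⇒⟨ a ⟩ G → H ⊢ F ⇒⟨ b ⟩ G
hweaken a≤b (inContext d) = inContext (weaken a≤b d)

lift : ∀ {H F G n} → F ⇒⟨ n ⟩ G → H ⊢ F ⇒⟨ n ⟩ G
lift {H} d = inContext (⇒-++ʳ H d)

hrefl : ∀ {H F} → H ⊢ F ⇒⟨ 0 ⟩ F
hrefl = lift ⇒-refl

hforgetˡ : ∀ {H F G J n} → Pos₀ᶠ J → H ⊢ F ⇒⟨ n ⟩ (J ++ G) → H ⊢ F ⇒⟨ n ⟩ G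
hforgetˡ {H} {G = G} {J} J≥0 (inContext d) =
  inContext (forgetʳ J≥0 (reshape-post d (↭⇒Reshape
    (↭-trans (↭-reflexive (++-assoc J G H)) (↭.++-comm J (G ++ H))))))

hframeʳ : ∀ {H F G n} R → H ⊢ F ⇒⟨ n ⟩ G → H ⊢ (F ++ R) ⇒⟨ n ⟩ (G ++ R)
hframeʳ {H} {F} {G} R (inContext d) =
  inContext (reshape-pre (↭⇒Reshape (++-swapʳ F R H))
                         (reshape-post (⇒-++ʳ R d) (↭⇒Reshape (↭-sym (++-swapʳ G R H)))))

hframeˡ : ∀ {H F G n} P → H ⊢ F ⇒⟨ n ⟩ G → H ⊢ (P ++ F) ⇒⟨ n ⟩ (P ++ G)
hframeˡ {H} {F} {G} P (inContext d) =
  inContext (reshape-pre (↭⇒Reshape (rotate F)) (reshape-post (⇒-++ʳ P d) (↭⇒Reshape (↭-sym (rotate G)))))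
  where
  rotate : ∀ X → (P ++ X) ++ H ↭ (X ++ H) ++ P
  rotate X = ↭-trans (↭-reflexive (++-assoc P X H)) (↭.++-comm P (X ++ H))

-- A hard clause may be duplicated for free, since ∞ = ∞ + ∞.
copy : ∀ {H C} → (C , ∞) ∈ H → H ⊢ [] ⇒⟨ 0 ⟩ [ (C , ∞) ]
copy {C = C} C∈H with ∈-∃++ C∈H
... | H₁ , H₂ , refl =
  inContext (reshape-post ⇒-refl
    (more (perm (↭.shift (C , ∞) H₁ H₂))
    (more (unmerge {u = ∞} {v = ∞} pos-∞ pos-∞)
    (↭⇒Reshape (prep (C , ∞) (↭-sym (↭.shift (C , ∞) H₁ H₂)))))))

⇒-proves : ∀ {H G n} → Posᶠ H → Posᶠ G → H ⊢ [] ⇒⟨ n ⟩ G → ∃[ e ] (e ≤ n × ProvesIn H G e)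
⇒-proves {H} {G} posH posG (inContext (derivation k k≤n E π J r J≥0)) with dropZeros (G ++ H) J J≥0
... | J' , r' , posJ' =
  k , k≤n , E , π , (G ++ H) ++ J' , Reshape-trans r r' ,
  ++⁺ (++⁺ posG posH) posJ' , ⊆⇒⊑ (λ c∈G → ∈-++⁺ˡ (∈-++⁺ˡ c∈G))

↭⇒~ : ∀ {C D} → C ↭ D → C ~ D
↭⇒~ p = (λ _ → ↭.∈-resp-↭ p) , (λ _ → ↭.∈-resp-↭ (↭-sym p))

++-absorb~ : ∀ {C D} → (∀ l → l ∈ D → l ∈ C) → (C ++ D) ~ C
++-absorb~ {C} D⊆C = absorb , (λ _ → ∈-++⁺ˡ)
  where
  absorb : ∀ l → l ∈ C ++ _ → l ∈ C
  absorb l l∈ with ∈-++⁻ C l∈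
  ... | inj₁ l∈C = l∈C
  ... | inj₂ l∈D = D⊆C l l∈D

coherent⇒¬Taut : ∀ {P : Lit → Set} {C} → (∀ {l} → P l → ¬ P (comp l)) → All P C → ¬ Taut C
coherent⇒¬Taut incoherent all taut with find taut
... | l , l∈C , l̄∈C = incoherent (All.lookup all l∈C) (All.lookup all l̄∈C)

data IsPos : Lit → Set where
  isPos : ∀ v → IsPos (pos v)

IsPos-coherent : ∀ {l} → IsPos l → ¬ IsPos (comp l)
IsPos-coherent (isPos v) ()

data NegOrOtherPos (v : Var) : Lit → Set where
  neg-v : NegOrOtherPos v (neg v)
  pos-≢ : ∀ {u} → ¬ u ≡ v → NegOrOtherPos v (pos u)

NegOrOtherPos-coherent : ∀ {v l} → NegOrOtherPos v l → ¬ NegOrOtherPos v (comp l)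
NegOrOtherPos-coherent neg-v     (pos-≢ v≢v) = v≢v refl
NegOrOtherPos-coherent (pos-≢ u≢v) neg-v     = u≢v refl

soft : Clause → WClause
soft C = (C , fin 1ℚ)

negExp-Pos₀ : ∀ E D {u} → Pos₀ u → Pos₀ᶠ (negExp E D u)
negExp-Pos₀ E []      u≥0 = []
negExp-Pos₀ E (l ∷ D) u≥0 = u≥0 ∷ negExp-Pos₀ (l ∷ E) D u≥0

resolve : ∀ y A B {v w} → Pos v → Pos w → minW v w ≡ fin 1ℚ →
          Pos₀ (v ⊖ fin 1ℚ) → Pos₀ (w ⊖ fin 1ℚ) → ¬ Taut (A ++ B) →
          ((pos y ∷ A , v) ∷ (neg y ∷ B , w) ∷ []) ⇒⟨ 1 ⟩ [ soft (A ++ B) ]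
resolve y A B {v} {w} pos-v pos-w min≡1 v-1≥0 w-1≥0 ¬taut =
  forgetʳ (filter⁺ nonTaut? leftovers≥0)
    (reshape-post
      (subst (λ μ → antecedents ⇒⟨ 1 ⟩ noTaut ((A ++ B , μ) ∷ leftovers μ)) min≡1
             (rule⇒ (resolution y A B v w pos-v pos-w)))
      (↭⇒Reshape (↭-reflexive (filter-accept nonTaut? ¬taut))))
  where
  nonTaut? = λ (c : WClause) → ¬? (taut? (proj₁ c))
  antecedents : Formula
  antecedents = (pos y ∷ A , v) ∷ (neg y ∷ B , w) ∷ []
  leftovers : W → Formula
  leftovers μ = (pos y ∷ A , v ⊖ μ) ∷ (neg y ∷ B , w ⊖ μ) ∷
                (negExp (pos y ∷ A) B μ ++ negExp (neg y ∷ B) A μ)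
  leftovers≥0 : Pos₀ᶠ (leftovers (fin 1ℚ))
  leftovers≥0 = v-1≥0 ∷ w-1≥0 ∷ ++⁺ (negExp-Pos₀ _ B (inj₁ Pos-1)) (negExp-Pos₀ _ A (inj₁ Pos-1))

□⁺ □⁻ : WClause
□⁺ = soft □
□⁻ = (□ , fin (- 1ℚ))

softNeg : Var → WClause
softNeg v = soft [ neg v ]

occupied : ℕ → ℕ → Clause
occupied j zero    = []
occupied j (suc r) = pos (x (suc r) j) ∷ occupied j r

occupied-coherent : ∀ j r {k} → r < k → All (NegOrOtherPos (x k j)) (occupied j r)
occupied-coherent j zero    r<k = []
occupied-coherent j (suc r) r<k = pos-≢ (λ { refl → <-irrefl refl r<k }) ∷ occupied-coherent j r (<-trans (n<1+n r) r<k)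

HoleClauses : Formula → ℕ → ℕ → Set
HoleClauses H j k = ∀ r → r < k → (neg (x (suc r) j) ∷ neg (x (suc k) j) ∷ [] , ∞) ∈ H

exclude : ∀ {H} j k → HoleClauses H j k → ∀ r → r ≤ k →
          H ⊢ [ soft (occupied j r ++ [ neg (x (suc k) j) ]) ] ⇒⟨ r ⟩ [ softNeg (x (suc k) j) ]
exclude j k hard zero    _   = hrefl
exclude j k hard (suc r) r<k =
  hframeˡ [ soft (occupied j (suc r) ++ [ v̄ ]) ] (copy (hard r r<k))
  ⨾ₕ lift (resolve (x (suc r) j) (occupied j r ++ [ v̄ ]) [ v̄ ] Pos-1 pos-∞ refl (inj₂ refl) (inj₁ pos-∞) ¬taut)
  ⨾ₕ more (rename (++-absorb~ λ { _ (here refl) → ∈-++⁺ʳ (occupied j r) (here refl) })) done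
  ↝⨾ exclude j k hard r (<⇒≤ r<k)
  where
  v̄ = neg (x (suc k) j)
  ¬taut : ¬ Taut ((occupied j r ++ [ v̄ ]) ++ [ v̄ ])
  ¬taut = coherent⇒¬Taut NegOrOtherPos-coherent
            (++⁺ (++⁺ (occupied-coherent j r (<-trans (n<1+n r) (s≤s r<k))) (neg-v ∷ [])) (neg-v ∷ []))

isolate : ∀ {H} j k → HoleClauses H j k →
          H ⊢ [ soft (occupied j k) ] ⇒⟨ suc k ⟩ (soft (occupied j (suc k)) ∷ [ softNeg (x (suc k) j) ])
isolate j k hard =
  lift (rule⇒ (split (occupied j k) (x (suc k) j) (fin 1ℚ) Pos-1))
  ⨾ₕ hframeˡ [ soft (occupied j (suc k)) ]
       (more (rename (↭⇒~ (↭.++-comm [ neg (x (suc k) j) ] (occupied j k)))) done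
        ↝⨾ exclude j k hard k ≤-refl)

range1↓ : ℕ → List ℕ
range1↓ n = map suc (downFrom n)

unitsOfHole : ℕ → ℕ → Formula
unitsOfHole j n = map (λ i → softNeg (x i j)) (range1↓ n)

triangle : ℕ → ℕ
triangle zero    = zero
triangle (suc n) = triangle n + suc n

isolateAll : ∀ {H} j n → (∀ k → k < n → HoleClauses H j k) →
             H ⊢ [ □⁺ ] ⇒⟨ triangle n ⟩ (soft (occupied j n) ∷ unitsOfHole j n)
isolateAll j zero    hard = hrefl
isolateAll j (suc n) hard =
  isolateAll j n (λ k k<n → hard k (<-trans k<n (n<1+n n)))
  ⨾ₕ hframeʳ (unitsOfHole j n) (isolate j n (hard n (n<1+n n)))

negs : ℕ → Formula
negs n = replicate n □⁻

holes : ∀ {H} m L → (∀ {j} → j ∈ L → ∀ k → k < suc m → HoleClauses H j k) →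
        H ⊢ [] ⇒⟨ length L * suc (triangle (suc m)) ⟩
          (negs (length L) ++ concatMap (λ j → unitsOfHole j (suc m)) L)
holes m []      hard = hrefl
holes m (j ∷ L) hard =
  lift (rule⇒ (virtual □ 1ℚ))
  ⨾ₕ hframeʳ [ □⁻ ] (hforgetˡ (inj₁ Pos-1 ∷ []) (isolateAll j (suc m) (hard (here refl))))
  ⨾ₕ ↭⇒Reshape (↭-trans (↭.++-comm U [ □⁻ ]) (↭-reflexive (sym (++-identityʳ (□⁻ ∷ U)))))
  ↝⨾ hframeˡ (□⁻ ∷ U) (holes m L (λ j∈L → hard (there j∈L)))
  ⨾↝ ↭⇒Reshape (prep □⁻ (↭.shifts U (negs (length L))))
  where
  U = unitsOfHole j (suc m)

pigeonClause : ℕ → List ℕ → Clause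
pigeonClause i L = map (λ j → pos (x i j)) L

unitsOfPigeon : ℕ → List ℕ → Formula
unitsOfPigeon i L = map (λ j → softNeg (x i j)) L

IsPos-pigeonClause : ∀ i L → All IsPos (pigeonClause i L)
IsPos-pigeonClause i []      = []
IsPos-pigeonClause i (j ∷ L) = isPos _ ∷ IsPos-pigeonClause i L

peel : ∀ {H} i L → H ⊢ (soft (pigeonClause i L) ∷ unitsOfPigeon i L) ⇒⟨ length L ⟩ [ □⁺ ]
peel i []      = hrefl
peel i (j ∷ L) =
  hframeʳ (unitsOfPigeon i L)
    (lift (resolve (x i j) (pigeonClause i L) [] Pos-1 Pos-1 refl (inj₂ refl) (inj₂ refl)
      (coherent⇒¬Taut IsPos-coherent (++⁺ (IsPos-pigeonClause i L) []))))
  ⨾ₕ more (rename (++-absorb~ λ _ ())) done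
  ↝⨾ peel i L

pigeon : ∀ {H} i L → (pigeonClause i L , ∞) ∈ H → H ⊢ unitsOfPigeon i L ⇒⟨ length L ⟩ [ □⁺ ]
pigeon i L P∈H =
  hforgetˡ (inj₁ pos-∞ ∷ [])
    (hframeʳ (unitsOfPigeon i L) (copy P∈H)
     ⨾ₕ more (unmerge {u = ∞} {v = fin 1ℚ} pos-∞ Pos-1) done
     ↝⨾ hframeˡ [ (pigeonClause i L , ∞) ] (peel i L))

pigeons : ∀ {H} L I → (∀ {i} → i ∈ I → (pigeonClause i L , ∞) ∈ H) →
          H ⊢ concatMap (λ i → unitsOfPigeon i L) I ⇒⟨ length I * length L ⟩ replicate (length I) □⁺
pigeons L []      hard = hrefl
pigeons L (i ∷ I) hard =
  hframeʳ (concatMap (λ i → unitsOfPigeon i L) I) (pigeon i L (hard (here refl)))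
  ⨾ₕ hframeˡ [ □⁺ ] (pigeons L I (λ i∈I → hard (there i∈I)))

cancel : ∀ {a b} n → a ≡ n → b ≡ suc n → Reshape (negs a ++ replicate b □⁺) [ □⁺ ]
cancel zero    refl refl = done
cancel (suc n) refl refl =
  more (perm (prep □⁻ (↭.shift □⁺ (negs n) (replicate (suc n) □⁺))))
    (more merge (more drop0 (cancel n refl refl)))

concatMap-∷ : ∀ {A B : Set} (f : B → A) (g : B → List A) L →
              concatMap (λ b → f b ∷ g b) L ↭ map f L ++ concatMap g L
concatMap-∷ f g []      = ↭-refl
concatMap-∷ f g (b ∷ L) =
  prep (f b) (↭-trans (↭.++⁺ˡ (g b) (concatMap-∷ f g L)) (↭.shifts (g b) (map f L)))

concatMap-[] : ∀ {A B : Set} (L : List B) → concatMap (λ _ → []) L ≡ [] {A = A}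
concatMap-[] []      = refl
concatMap-[] (b ∷ L) = concatMap-[] L

concatMap-transpose : ∀ {A B C : Set} (f : B → C → A) I L →
  concatMap (λ j → map (λ i → f i j) I) L ↭ concatMap (λ i → map (λ j → f i j) L) I
concatMap-transpose f []      L = ↭-reflexive (concatMap-[] L)
concatMap-transpose f (i ∷ I) L =
  ↭-trans (concatMap-∷ (f i) (λ j → map (λ i → f i j) I) L)
          (↭.++⁺ˡ (map (f i) L) (concatMap-transpose f I L))

∈-range1⁺ : ∀ {i n} → i < n → suc i ∈ range1 n
∈-range1⁺ i<n = ∈-map⁺ suc (∈-upTo⁺ i<n)

range1↓⊆range1 : ∀ {i n} → i ∈ range1↓ n → i ∈ range1 n
range1↓⊆range1 i∈ with ∈-map⁻ suc i∈
... | _ , i'∈ , refl = ∈-range1⁺ (∈-downFrom⁻ i'∈)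

pigeonClause∈PHP : ∀ {m i} → i ∈ range1 (suc m) → (pigeonClause i (range1 m) , ∞) ∈ PHP m
pigeonClause∈PHP i∈ = ∈-map⁺ _ (∈-++⁺ˡ (∈-map⁺ _ i∈))

holeClause∈PHP : ∀ {m j} → j ∈ range1 m → ∀ k → k < suc m → HoleClauses (PHP m) j k
holeClause∈PHP {m} {j} j∈ k k<m+1 r r<k with m≤n⇒∃[o]m+o≡n r<k
... | d , refl = ∈-map⁺ _ (∈-++⁺ʳ _ (∈-concat⁺′ (∈-concat⁺′ clause∈ (∈-map⁺ _ (∈-range1⁺ r<m+1))) (∈-map⁺ _ j∈)))
  where
  clausesFrom : ℕ → List Clause
  clausesFrom i = map (λ d → neg (x i j) ∷ neg (x (i + suc d) j) ∷ []) (upTo (suc m ∸ i))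
  d<bound : d < suc m ∸ suc r
  d<bound = m+n≤o⇒m≤o∸n (suc d) (subst (_≤ m) (cong suc (+-comm r d)) (≤-pred k<m+1))
  clause∈ : (neg (x (suc r) j) ∷ neg (x (suc (suc (r + d))) j) ∷ []) ∈ clausesFrom (suc r)
  clause∈ = subst (λ i → (neg (x (suc r) j) ∷ neg (x i j) ∷ []) ∈ clausesFrom (suc r))
                  (cong suc (+-suc r d)) (∈-map⁺ _ (∈-upTo⁺ d<bound))
  r<m+1 : r < suc m
  r<m+1 = ≤-trans (s≤s (m≤m+n r d)) (<⇒≤ k<m+1)

length-range1 : ∀ n → length (range1 n) ≡ n
length-range1 n = trans (length-map suc (upTo n)) (length-upTo n)

length-range1↓ : ∀ n → length (range1↓ n) ≡ n
length-range1↓ n = trans (length-map suc (downFrom n)) (length-downFrom n)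

triangle≤square : ∀ n → triangle n ≤ n * n
triangle≤square zero    = z≤n
triangle≤square (suc n) = begin
  triangle n + suc n ≤⟨ +-monoˡ-≤ (suc n) (triangle≤square n) ⟩
  n * n + suc n      ≡⟨ +-comm (n * n) (suc n) ⟩
  suc n + n * n      ≤⟨ +-monoʳ-≤ (suc n) (*-monoʳ-≤ n (n≤1+n n)) ⟩
  suc n * suc n      ∎
  where open ≤-Reasoning

refutation-length≤ : ∀ {a b} m → a ≡ m → b ≡ suc m → a * suc (triangle (suc m)) + b * a ≤ suc m ^ 3
refutation-length≤ m refl refl = begin
  m * suc (triangle (suc m)) + suc m * m    ≤⟨ +-monoˡ-≤ (suc m * m) (*-monoʳ-≤ m (s≤s (triangle≤square (suc m)))) ⟩
  m * suc (suc m * suc m) + suc m * m       ≤⟨ m≤m+n _ 1 ⟩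
  m * suc (suc m * suc m) + suc m * m + 1   ≡⟨ cube m ⟩
  suc m ^ 3                                 ∎
  where
  open ≤-Reasoning
  open +-*-Solver using (solve; _:+_; _:*_; _:^_; con; _:=_)
  cube : ∀ m → m * suc (suc m * suc m) + suc m * m + 1 ≡ suc m ^ 3
  cube = solve 1 (λ m → m :* (con 1 :+ (con 1 :+ m) :* (con 1 :+ m)) :+ (con 1 :+ m) :* m :+ con 1
                        := (con 1 :+ m) :^ 3) refl

suc-cube≤ : ∀ {m} → 1 ≤ m → suc m ^ 3 ≤ 8 * m ^ 3 + 8
suc-cube≤ {m} 1≤m = begin
  suc m ^ 3        ≤⟨ ^-monoˡ-≤ 3 (+-monoˡ-≤ m 1≤m) ⟩
  (m + m) ^ 3      ≡⟨ solve 1 (λ m → (m :+ m) :^ 3 := con 8 :* m :^ 3) refl m ⟩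
  8 * m ^ 3        ≤⟨ m≤m+n _ 8 ⟩
  8 * m ^ 3 + 8    ∎
  where
  open ≤-Reasoning
  open +-*-Solver using (solve; _:+_; _:*_; _:^_; con; _:=_)

php-refutation : ∀ m → PHP m ⊢ [] ⇒⟨ suc m ^ 3 ⟩ [ □⁺ ]
php-refutation m =
  hweaken (refutation-length≤ m (length-range1 m) (length-range1↓ (suc m)))
    (byHole ⨾ₕ regroup ↝⨾ hframeˡ (negs (length L)) byPigeon ⨾↝ cancel m (length-range1 m) (length-range1↓ (suc m)))
  where
  L = range1 m
  I = range1↓ (suc m)
  byHole : PHP m ⊢ [] ⇒⟨ length L * suc (triangle (suc m)) ⟩
             (negs (length L) ++ concatMap (λ j → unitsOfHole j (suc m)) L)
  byHole = holes m L holeClause∈PHP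
  regroup : Reshape (negs (length L) ++ concatMap (λ j → unitsOfHole j (suc m)) L)
                    (negs (length L) ++ concatMap (λ i → unitsOfPigeon i L) I)
  regroup = ↭⇒Reshape (↭.++⁺ˡ (negs (length L)) (concatMap-transpose (λ i j → softNeg (x i j)) I L))
  byPigeon : PHP m ⊢ concatMap (λ i → unitsOfPigeon i L) I ⇒⟨ length I * length L ⟩ replicate (length I) □⁺
  byPigeon = pigeons L I (λ i∈I → pigeonClause∈PHP (range1↓⊆range1 i∈I))

theorem12 : ∃[ c ] ∃[ k ] ((m : ℕ) → 1 ≤ m →
    ∃[ e ] (e ≤ c * m ^ k + c × ProvesIn (PHP m) ((□ , fin 1ℚ) ∷ []) e))
theorem12 = 8 , 3 , λ m 1≤m →
  let e , e≤ , proof = ⇒-proves (Posᶠ-hard (K m)) (Pos-1 ∷ []) (php-refutation m)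
  in  e , ≤-trans e≤ (suc-cube≤ 1≤m) , proof
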